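{- Let $\mathsf A,\mathsf A',\mathsf B,\mathsf B'\in\mathfrak T$ with $\mathsf A\cong_{\mathfrak T}\mathsf A'$ and $\mathsf B\cong_{\mathfrak T}\mathsf B'$, and let $V$ be a type variable or datatype variable. Then $\mathsf A\{V:=\mathsf B\}\cong_{\mathfrak T}\mathsf A'\{V:=\mathsf B'\}$.
   Context: $\mathfrak{T}$ is the set of possibly infinite trees (metric completion) over the ranked alphabet with nullary symbols $a$ ranging over type variables and type constants and binary symbols $@,\supset,\oplus$, excluding trees having an infinite branch of only $\oplus$ nodes; a tree is a partial map from positions (strings over $\{1,2\}$) to symbols. Every tree can be written as a maximal union $\bigoplus_{i\in1..n}\mathsf A_i$ (any association) whose components do not have $\oplus$ at the root. $\cong_{\mathfrak T}$ is the coinductive interpretation of: $a\cong a$; $\mathsf D@\mathsf A\cong\mathsf D'@\mathsf A'$ if $\mathsf D\cong\mathsf D'$, $\mathsf A\cong\mathsf A'$; $\mathsf A\supset\mathsf B\cong\mathsf A'\supset\mathsf B'$ if $\mathsf A\cong\mathsf A'$, $\mathsf B\cong\mathsf B'$; for maximal unions with $n+m>2$, $\bigoplus_{i\in1..n}\mathsf A_i\cong\bigoplus_{j\in1..m}\mathsf B_j$ if there are $f:1..n\to1..m$, $g:1..m\to1..n$ with $\mathsf A_i\cong\mathsf B_{f(i)}$ and $\mathsf A_{g(j)}\cong\mathsf B_j$. Tree substitution: $(\mathsf A\{V:=\mathsf B\})(\pi)=\mathsf A(\pi)$ if $\mathsf A(\pi)$ is defined and $\neq V$; $(\mathsf A\{V:=\mathsf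 B\})(\pi\pi')=\mathsf B(\pi')$ if $\mathsf A(\pi)=V$. -}

module Defs where

open import Data.Nat using (ℕ; zero; suc)
open import Data.List using (List; []; _∷_; _++_)
open import Data.Maybe using (Maybe; just; nothing)
open import Data.Product using (Σ; ∃; _×_; _,_)
open import Data.Sum using (_⊎_)
open import Relation.Binary.PropositionalEquality using (_≡_; refl)
open import Relation.Nullary using (¬_; Dec; yes; no)
open import Data.Empty using (⊥)
open import Data.Nat using (_≟_)

data Var : Set where
  tyVar : ℕ → Var
  dtVar : ℕ → Var

data Atom : Set where
  var : Var → Atom
  con : ℕ → Atom

-- Ranked alphabet: nullary atoms, binary @ (app), ⊃ (arr), ⊕ (plus).
data Sym : Set where
  atom : Atom → Sym
  app  : Sym
  arr  : Sym
  plus : Sym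

data Dir : Set where
  d1 d2 : Dir

Pos : Set
Pos = List Dir

RawTree : Set
RawTree = Pos → Maybe Sym

sub : RawTree → Pos → RawTree
sub t p = λ r → t (p ++ r)

prefix : (ℕ → Dir) → ℕ → Pos
prefix f zero    = []
prefix f (suc n) = f zero ∷ prefix (λ k → f (suc k)) n

data IsBinary : Sym → Set where
  app-bin  : IsBinary app
  arr-bin  : IsBinary arr
  plus-bin : IsBinary plus

-- Membership in 𝔗: well-formed (possibly infinite) trees over the ranked
-- alphabet, with no infinite branch consisting only of ⊕ nodes.
record IsTree (t : RawTree) : Set where
  field
    root     : ∃ λ s → t [] ≡ just s
    leaf     : ∀ p a d → t p ≡ just (atom a) → t (p ++ d ∷ []) ≡ nothing
    node     : ∀ p s d → t p ≡ just s → IsBinary s → ∃ λ s' → t (p ++ d ∷ []) ≡ just s'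
    closed   : ∀ p d → t p ≡ nothing → t (p ++ d ∷ []) ≡ nothing
    noInfPlus : ∀ (p : Pos) (f : ℕ → Dir) → ¬ (∀ n → t (p ++ prefix f n) ≡ just plus)

-- q is the position of a component of the maximal union decomposition of t:
-- all proper prefixes of q carry ⊕, and q carries a non-⊕ symbol.
Comp : RawTree → Pos → Set
Comp t []      = ∃ λ s → t [] ≡ just s × ¬ (s ≡ plus)
Comp t (d ∷ q) = t [] ≡ just plus × Comp (sub t (d ∷ [])) q

-- One unfolding of the rules defining ≅_𝔗, relative to a relation R.
Step : (RawTree → RawTree → Set) → RawTree → RawTree → Set
Step R A B =
    (∃ λ a → A [] ≡ just (atom a) × B [] ≡ just (atom a))
  ⊎ (A [] ≡ just app × B [] ≡ just app
       × R (sub A (d1 ∷ [])) (sub B (d1 ∷ [])) × R (sub A (d2 ∷ [])) (sub B (d2 ∷ [])))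
  ⊎ (A [] ≡ just arr × B [] ≡ just arr
       × R (sub A (d1 ∷ [])) (sub B (d1 ∷ [])) × R (sub A (d2 ∷ [])) (sub B (d2 ∷ [])))
  ⊎ ((A [] ≡ just plus ⊎ B [] ≡ just plus)
       × (∀ q → Comp A q → ∃ λ r → Comp B r × R (sub A q) (sub B r))
       × (∀ r → Comp B r → ∃ λ q → Comp A q × R (sub A q) (sub B r)))

-- Coinductive interpretation: A ≅ B iff (A,B) lies in some post-fixed point.
_≅_ : RawTree → RawTree → Set₁
A ≅ B = Σ (RawTree → RawTree → Set) λ R → (∀ X Y → R X Y → Step R X Y) × R A B

varEq : (V W : Var) → Dec (V ≡ W)
varEq (tyVar m) (tyVar n) with m ≟ n
... | yes refl = yes refl
... | no ne = no λ { refl → ne refl }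
varEq (dtVar m) (dtVar n) with m ≟ n
... | yes refl = yes refl
... | no ne = no λ { refl → ne refl }
varEq (tyVar m) (dtVar n) = no λ ()
varEq (dtVar m) (tyVar n) = no λ ()

-- Tree substitution A{V:=B}: walk down π; if a prefix of π is labelled V
-- in A, continue in B with the remaining suffix, else return A(π).
subst : RawTree → Var → RawTree → RawTree
subst A V B π = go (A []) π
  where
  go : Maybe Sym → Pos → Maybe Sym
  go (just (atom (var W))) π' with varEq W V
  ... | yes _ = B π'
  ... | no _  = substRest π'
    where
    substRest : Pos → Maybe Sym
    substRest []      = A []
    substRest (d ∷ q) = subst (sub A (d ∷ [])) V B q
  go _ []      = A []
  go _ (d ∷ q) = subst (sub A (d ∷ [])) V B q

module Submission where

-- Given post-fixed points R₁ ∋ (A, A′) and R₂ ∋ (B, B′) of Step, we show that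
--   SubstRel = { (A{V:=B}, A′{V:=B′}) | R₁ A A′ } ∪ R₂,
-- closed under pointwise equality of trees, is again post-fixed.

open import Defs
open import Data.Empty using (⊥-elim)
open import Data.List using ([]; _∷_; _++_)
open import Data.List.Properties using (++-assoc; ++-identityʳ)
open import Data.Maybe using (just; nothing)
open import Data.Maybe.Properties using (just-injective)
open import Data.Product using (∃; _×_; _,_; proj₁; proj₂)
open import Data.Sum using (inj₁; inj₂; swap) renaming (map to ⊎-map)
open import Function using (flip)
open import Relation.Binary.PropositionalEquality
  using (_≡_; refl; sym; trans; cong; module ≡-Reasoning)
import Relation.Binary.PropositionalEquality as Eq
open import Relation.Nullary using (¬_; Dec; yes; no)

-- Pointwise equality of trees; substitution only produces trees equal to
-- the expected ones in this sense (there is no function extensionality).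
_≐_ : RawTree → RawTree → Set
X ≐ Y = ∀ π → X π ≡ Y π

≐-refl : ∀ {X} → X ≐ X
≐-refl π = refl

≐-sym : ∀ {X Y} → X ≐ Y → Y ≐ X
≐-sym p π = sym (p π)

≐-trans : ∀ {X Y Z} → X ≐ Y → Y ≐ Z → X ≐ Z
≐-trans p q π = trans (p π) (q π)

≐-root : ∀ {X Y m} → X ≐ Y → X [] ≡ m → Y [] ≡ m
≐-root p e = trans (sym (p [])) e

sub-≐ : ∀ {X Y} q → X ≐ Y → sub X q ≐ sub Y q
sub-≐ q p π = p (q ++ π)

comp-≐ : ∀ {X Y} q → X ≐ Y → Comp X q → Comp Y q
comp-≐ []      p (s , e , s≢plus) = s , ≐-root p e , s≢plus
comp-≐ (d ∷ q) p (e , c)          = ≐-root p e , comp-≐ q (sub-≐ (d ∷ []) p) c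

compRoot : ∀ {X} q → Comp X q → Comp (sub X q) []
compRoot []      c       = c
compRoot (d ∷ q) (_ , c) = compRoot q c

compRoot-notPlus : ∀ {X} → Comp X [] → ¬ X [] ≡ just plus
compRoot-notPlus (s , e , s≢plus) e′ = s≢plus (just-injective (trans (sym e) e′))

TreeRel : Set₁
TreeRel = RawTree → RawTree → Set

PostFixed : TreeRel → Set
PostFixed R = ∀ X Y → R X Y → Step R X Y

-- The forward half of the ⊕-rule: every component of P is R-related to
-- some component of Q.  Step's backward half is Covers (flip R) Q P.
Covers : TreeRel → RawTree → RawTree → Set
Covers R P Q = ∀ q → Comp P q → ∃ λ r → Comp Q r × R (sub P q) (sub Q r)

_⊆≐_ : TreeRel → TreeRel → Set
R ⊆≐ R′ = ∀ {X Y X′ Y′} → X ≐ X′ → Y ≐ Y′ → R X Y → R′ X′ Y′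

flip-⊆≐ : ∀ {R R′} → R ⊆≐ R′ → flip R ⊆≐ flip R′
flip-⊆≐ h px py r = h py px r

covers-⊆≐ : ∀ {R R′ X Y X′ Y′} → R ⊆≐ R′ → X ≐ X′ → Y ≐ Y′
          → Covers R X Y → Covers R′ X′ Y′
covers-⊆≐ h px py cov q c with cov q (comp-≐ q (≐-sym px) c)
... | r , cr , rr = r , comp-≐ r py cr , h (sub-≐ q px) (sub-≐ r py) rr

step-⊆≐ : ∀ {R R′ X Y X′ Y′} → R ⊆≐ R′ → X ≐ X′ → Y ≐ Y′
        → Step R X Y → Step R′ X′ Y′
step-⊆≐ h px py (inj₁ (a , e , e′)) = inj₁ (a , ≐-root px e , ≐-root py e′)
step-⊆≐ h px py (inj₂ (inj₁ (e , e′ , r₁ , r₂))) =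
  inj₂ (inj₁ (≐-root px e , ≐-root py e′ ,
              h (sub-≐ _ px) (sub-≐ _ py) r₁ , h (sub-≐ _ px) (sub-≐ _ py) r₂))
step-⊆≐ h px py (inj₂ (inj₂ (inj₁ (e , e′ , r₁ , r₂)))) =
  inj₂ (inj₂ (inj₁ (≐-root px e , ≐-root py e′ ,
                    h (sub-≐ _ px) (sub-≐ _ py) r₁ , h (sub-≐ _ px) (sub-≐ _ py) r₂)))
step-⊆≐ h px py (inj₂ (inj₂ (inj₂ (pl , f , g)))) =
  inj₂ (inj₂ (inj₂ (⊎-map (≐-root px) (≐-root py) pl ,
                    covers-⊆≐ h px py f , covers-⊆≐ (flip-⊆≐ h) py px g)))

step-flip : ∀ {R P Q} → Step R P Q → Step (flip R) Q P
step-flip (inj₁ (a , e , e′))                      = inj₁ (a , e′ , e)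
step-flip (inj₂ (inj₁ (e , e′ , r₁ , r₂)))          = inj₂ (inj₁ (e′ , e , r₁ , r₂))
step-flip (inj₂ (inj₂ (inj₁ (e , e′ , r₁ , r₂))))   = inj₂ (inj₂ (inj₁ (e′ , e , r₁ , r₂)))
step-flip (inj₂ (inj₂ (inj₂ (pl , f , g))))         = inj₂ (inj₂ (inj₂ (swap pl , g , f)))

postFixed-flip : ∀ {R} → PostFixed R → PostFixed (flip R)
postFixed-flip {R} post X Y r = step-flip {R} (post Y X r)

covers-nonPlusRoot : ∀ {R P Q s} → P [] ≡ just s → Q [] ≡ just s → ¬ s ≡ plus
                   → R P Q → Covers R P Q
covers-nonPlusRoot eP eQ s≢plus rPQ []      _         = [] , (_ , eQ , s≢plus) , rPQ
covers-nonPlusRoot eP eQ s≢plus rPQ (d ∷ q) (ePlus , _) =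
  ⊥-elim (s≢plus (just-injective (trans (sym eP) ePlus)))

step-covers : ∀ {R P Q} → Step R P Q → R P Q → Covers R P Q
step-covers {R} {P} {Q} (inj₁ (a , e , e′))               = covers-nonPlusRoot {R} {P} {Q} e e′ λ ()
step-covers {R} {P} {Q} (inj₂ (inj₁ (e , e′ , _)))        = covers-nonPlusRoot {R} {P} {Q} e e′ λ ()
step-covers {R} {P} {Q} (inj₂ (inj₂ (inj₁ (e , e′ , _)))) = covers-nonPlusRoot {R} {P} {Q} e e′ λ ()
step-covers (inj₂ (inj₂ (inj₂ (_ , f , _)))) _            = f

step-root : ∀ {R P Q} → Step R P Q → Comp P [] → Comp Q [] → P [] ≡ Q []
step-root (inj₁ (a , e , e′))                       _  _  = trans e (sym e′)
step-root (inj₂ (inj₁ (e , e′ , _)))                _  _  = trans e (sym e′)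
step-root (inj₂ (inj₂ (inj₁ (e , e′ , _))))         _  _  = trans e (sym e′)
step-root {P = P} (inj₂ (inj₂ (inj₂ (inj₁ e , _)))) cP _  = ⊥-elim (compRoot-notPlus {P} cP e)
step-root {Q = Q} (inj₂ (inj₂ (inj₂ (inj₂ e , _)))) _  cQ = ⊥-elim (compRoot-notPlus {Q} cQ e)

VRoot : Var → RawTree → Set
VRoot V A = A [] ≡ just (atom (var V))

vRoot? : ∀ V A → Dec (VRoot V A)
vRoot? V A with A []
... | just (atom (var W)) with varEq W V
...   | yes refl = yes refl
...   | no W≢V   = no λ { refl → W≢V refl }
vRoot? V A | just (atom (con c)) = no λ ()
vRoot? V A | just app            = no λ ()
vRoot? V A | just arr            = no λ ()
vRoot? V A | just plus           = no λ ()
vRoot? V A | nothing             = no λ ()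

notVRoot : ∀ {V s} A → A [] ≡ just s → ¬ s ≡ atom (var V) → ¬ VRoot V A
notVRoot A e s≢V v = s≢V (just-injective (trans (sym e) v))

module Substitution (V : Var) (B : RawTree) where

  S : RawTree → RawTree
  S A = subst A V B

  substAtV : ∀ A → VRoot V A → S A ≐ B
  substAtV A v π rewrite v with varEq V V
  ... | yes _   = refl
  ... | no V≢V  = ⊥-elim (V≢V refl)

  substNotV : ∀ A → ¬ VRoot V A
            → S A [] ≡ A [] × (∀ d → sub (S A) (d ∷ []) ≐ S (sub A (d ∷ [])))
  substNotV A nv with A [] in e
  ... | just (atom (var W)) with varEq W V
  ...   | yes refl = ⊥-elim (nv refl)
  ...   | no _     = e , λ _ _ → refl
  substNotV A nv | just (atom (con c)) = e , λ _ _ → refl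
  substNotV A nv | just app            = e , λ _ _ → refl
  substNotV A nv | just arr            = e , λ _ _ → refl
  substNotV A nv | just plus           = e , λ _ _ → refl
  substNotV A nv | nothing             = e , λ _ _ → refl

  substRoot : ∀ A → ¬ VRoot V A → S A [] ≡ A []
  substRoot A nv = proj₁ (substNotV A nv)

  substChild : ∀ A → ¬ VRoot V A → ∀ d → sub (S A) (d ∷ []) ≐ S (sub A (d ∷ []))
  substChild A nv = proj₂ (substNotV A nv)

  rootPreserved : ∀ A {s} → A [] ≡ just s → ¬ s ≡ atom (var V) → S A [] ≡ just s
  rootPreserved A e s≢V = trans (substRoot A (notVRoot A e s≢V)) e

  plusNotV : ∀ A → A [] ≡ just plus → ¬ VRoot V A
  plusNotV A e = notVRoot A e λ ()

  substSub : ∀ A q → Comp A q → sub (S A) q ≐ S (sub A q)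
  substSub A []      _       π = refl
  substSub A (d ∷ q) (e , c) π =
    trans (substChild A (plusNotV A e) d (q ++ π)) (substSub (sub A (d ∷ [])) q c π)

  liftComp : ∀ A q {r} → Comp A q → Comp (S (sub A q)) r → Comp (S A) (q ++ r)
  liftComp A []      _        c = c
  liftComp A (d ∷ q) (e , cA) c =
    rootPreserved A e (λ ()) ,
    comp-≐ _ (≐-sym (substChild A (plusNotV A e) d)) (liftComp (sub A (d ∷ [])) q cA c)

  keptComp : ∀ A q → Comp A q → ¬ VRoot V (sub A q) → Comp (S A) q
  keptComp A q c nv with compRoot q c
  ... | s , e , s≢plus =
    Eq.subst (Comp (S A)) (++-identityʳ q)
      (liftComp A q c (s , trans (substRoot (sub A q) nv) e , s≢plus))

  graftedComp : ∀ A q {r} → Comp A q → VRoot V (sub A q) → Comp B r → Comp (S A) (q ++ r)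
  graftedComp A q c v cB = liftComp A q c (comp-≐ _ (≐-sym (substAtV (sub A q) v)) cB)

  graftedSub : ∀ A q r → Comp A q → VRoot V (sub A q) → sub (S A) (q ++ r) ≐ sub B r
  graftedSub A q r c v π = begin
    S A ((q ++ r) ++ π)   ≡⟨ cong (S A) (++-assoc q r π) ⟩
    S A (q ++ (r ++ π))   ≡⟨ substSub A q c (r ++ π) ⟩
    S (sub A q) (r ++ π)  ≡⟨ substAtV (sub A q) v (r ++ π) ⟩
    B (r ++ π)            ∎
    where open ≡-Reasoning

  data SubstComp (A : RawTree) : Pos → Set where
    kept    : ∀ {q} → Comp A q → ¬ VRoot V (sub A q) → SubstComp A q
    grafted : ∀ {q r} → Comp A q → VRoot V (sub A q) → Comp B r → SubstComp A (q ++ r)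

  classify : ∀ A q → Comp (S A) q → SubstComp A q
  classify A q c with vRoot? V A
  ... | yes v = grafted {q = []} (_ , v , λ ()) v (comp-≐ q (substAtV A v) c)
  classify A []      (s , e , s≢plus) | no nv =
    kept (s , trans (sym (substRoot A nv)) e , s≢plus) nv
  classify A (d ∷ q) (e , c)          | no nv
    with classify (sub A (d ∷ [])) q (comp-≐ q (substChild A nv d) c)
  ... | kept cq nv′      = kept (trans (sym (substRoot A nv)) e , cq) nv′
  ... | grafted cq v cB  = grafted (trans (sym (substRoot A nv)) e , cq) v cB

module SubstitutionRelation (V : Var) (B B′ : RawTree) (R₁ R₂ : TreeRel)
       (post₁ : PostFixed R₁) (post₂ : PostFixed R₂) (rB : R₂ B B′) where

  module S  = Substitution V B
  module S′ = Substitution V B′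

  data SubstRel (X Y : RawTree) : Set where
    substituted : ∀ {A A′} → R₁ A A′ → X ≐ S.S A → Y ≐ S′.S A′ → SubstRel X Y
    replaced    : ∀ {C C′} → R₂ C C′ → X ≐ C → Y ≐ C′ → SubstRel X Y

  -- R₁-matched components have the same root, in particular both or neither are V.
  matchedRoot : ∀ A A′ q r → R₁ (sub A q) (sub A′ r) → Comp A q → Comp A′ r
              → sub A q [] ≡ sub A′ r []
  matchedRoot A A′ q r rr cq cr =
    step-root {R₁} {sub A q} {sub A′ r} (post₁ _ _ rr) (compRoot q cq) (compRoot r cr)

  coverComponent : ∀ A A′ {q} → Covers R₁ A A′ → S.SubstComp A q
                 → ∃ λ r → Comp (S′.S A′) r × SubstRel (sub (S.S A) q) (sub (S′.S A′) r)
  coverComponent A A′ cov (S.kept {q} cq nv) with cov q cq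
  ... | r , cr , rr =
    r , S′.keptComp A′ r cr (λ v → nv (trans (matchedRoot A A′ q r rr cq cr) v)) ,
    substituted rr (S.substSub A q cq) (S′.substSub A′ r cr)
  coverComponent A A′ cov (S.grafted {q} {r} cq v cB)
    with cov q cq | step-covers {R₂} {B} {B′} (post₂ B B′ rB) rB r cB
  ... | q′ , cq′ , rr | r′ , cB′ , rb =
    q′ ++ r′ , S′.graftedComp A′ q′ cq′ v′ cB′ ,
    replaced rb (S.graftedSub A q r cq v) (S′.graftedSub A′ q′ r′ cq′ v′)
    where
    v′ : VRoot V (sub A′ q′)
    v′ = trans (sym (matchedRoot A A′ q q′ rr cq cq′)) v

  coversSubst : ∀ A A′ → Covers R₁ A A′ → Covers SubstRel (S.S A) (S′.S A′)
  coversSubst A A′ cov q c = coverComponent A A′ cov (S.classify A q c)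

module SubstitutionBisimulation (V : Var) (B B′ : RawTree) (R₁ R₂ : TreeRel)
       (post₁ : PostFixed R₁) (post₂ : PostFixed R₂) (rB : R₂ B B′) where

  open SubstitutionRelation V B B′ R₁ R₂ post₁ post₂ rB public

  -- The same construction with both sides exchanged, for the backward half.
  private
    module Mirror = SubstitutionRelation V B′ B (flip R₁) (flip R₂)
                      (postFixed-flip post₁) (postFixed-flip post₂) rB

  mirror : Mirror.SubstRel ⊆≐ flip SubstRel
  mirror px py (Mirror.substituted r qx qy) = substituted r (≐-trans (≐-sym py) qy) (≐-trans (≐-sym px) qx)
  mirror px py (Mirror.replaced r qx qy)    = replaced r (≐-trans (≐-sym py) qy) (≐-trans (≐-sym px) qx)

  substRel-⊆≐ : SubstRel ⊆≐ SubstRel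
  substRel-⊆≐ px py (substituted r qx qy) = substituted r (≐-trans (≐-sym px) qx) (≐-trans (≐-sym py) qy)
  substRel-⊆≐ px py (replaced r qx qy)    = replaced r (≐-trans (≐-sym px) qx) (≐-trans (≐-sym py) qy)

  R₂-⊆≐ : R₂ ⊆≐ SubstRel
  R₂-⊆≐ px py r = replaced r (≐-sym px) (≐-sym py)

  binaryStep : ∀ A A′ {s} → A [] ≡ just s → A′ [] ≡ just s → ¬ s ≡ atom (var V)
    → R₁ (sub A (d1 ∷ [])) (sub A′ (d1 ∷ [])) → R₁ (sub A (d2 ∷ [])) (sub A′ (d2 ∷ []))
    → S.S A [] ≡ just s × S′.S A′ [] ≡ just s
      × SubstRel (sub (S.S A) (d1 ∷ [])) (sub (S′.S A′) (d1 ∷ []))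
      × SubstRel (sub (S.S A) (d2 ∷ [])) (sub (S′.S A′) (d2 ∷ []))
  binaryStep A A′ e e′ s≢V r₁ r₂ =
    S.rootPreserved A e s≢V , S′.rootPreserved A′ e′ s≢V , child d1 r₁ , child d2 r₂
    where
    child : ∀ d → R₁ (sub A (d ∷ [])) (sub A′ (d ∷ []))
          → SubstRel (sub (S.S A) (d ∷ [])) (sub (S′.S A′) (d ∷ []))
    child d r = substituted r (S.substChild A (notVRoot A e s≢V) d)
                              (S′.substChild A′ (notVRoot A′ e′ s≢V) d)

  -- Each rule relating A and A′ yields a rule relating their substitution
  -- instances; at a V-leaf the rule relating B and B′ is used instead.
  stepSubst : ∀ A A′ → R₁ A A′ → Step SubstRel (S.S A) (S′.S A′)
  stepSubst A A′ r with post₁ A A′ r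
  ... | inj₁ (a , e , e′) with vRoot? V A
  ...   | yes v = step-⊆≐ {R₂} R₂-⊆≐ (≐-sym (S.substAtV A v))
                    (≐-sym (S′.substAtV A′ (trans e′ (trans (sym e) v)))) (post₂ B B′ rB)
  ...   | no nv = inj₁ (a , S.rootPreserved A e a≢V , S′.rootPreserved A′ e′ a≢V)
    where
    a≢V : ¬ atom a ≡ atom (var V)
    a≢V eq = nv (trans e (cong just eq))
  stepSubst A A′ r | inj₂ (inj₁ (e , e′ , r₁ , r₂)) =
    inj₂ (inj₁ (binaryStep A A′ e e′ (λ ()) r₁ r₂))
  stepSubst A A′ r | inj₂ (inj₂ (inj₁ (e , e′ , r₁ , r₂))) =
    inj₂ (inj₂ (inj₁ (binaryStep A A′ e e′ (λ ()) r₁ r₂)))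
  stepSubst A A′ r | inj₂ (inj₂ (inj₂ (pl , f , g))) =
    inj₂ (inj₂ (inj₂ (⊎-map (λ e → S.rootPreserved A e (λ ())) (λ e → S′.rootPreserved A′ e (λ ())) pl ,
                      coversSubst A A′ f ,
                      covers-⊆≐ {Mirror.SubstRel} mirror ≐-refl ≐-refl (Mirror.coversSubst A′ A g))))

  substRel-postFixed : PostFixed SubstRel
  substRel-postFixed X Y (substituted {A} {A′} r px py) =
    step-⊆≐ {SubstRel} substRel-⊆≐ (≐-sym px) (≐-sym py) (stepSubst A A′ r)
  substRel-postFixed X Y (replaced {C} {C′} r px py) =
    step-⊆≐ {R₂} R₂-⊆≐ (≐-sym px) (≐-sym py) (post₂ C C′ r)

lemma3p13 : (A A′ B B′ : RawTree) (V : Var)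
    → IsTree A → IsTree A′ → IsTree B → IsTree B′
    → A ≅ A′ → B ≅ B′
    → subst A V B ≅ subst A′ V B′
lemma3p13 A A′ B B′ V _ _ _ _ (R₁ , post₁ , rA) (R₂ , post₂ , rB) =
  SubstRel , substRel-postFixed , substituted rA ≐-refl ≐-refl
  where open SubstitutionBisimulation V B B′ R₁ R₂ post₁ post₂ rB
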